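{- Let $G=(V,E)$ be a simple connected graph with an embedding given by a rotation system, and let $v\in V$ with $d=\deg(v)$. Let $s'_v[1],\dots,s'_v[d]$ be the non-decreasing sequence of the values $f(\alpha)$ for $\alpha\in A(v)$. Let $s'_{1,v}[1],\dots,s'_{1,v}[d]$ be the non-decreasing sequence of the values $f_w(e)$ over all directed edges $e$ starting at $v$. Define $s'_{2,v}[i]=s'_{1,v}[i+1]$ for $1\le i<d$ and $s'_{2,v}[d]=s'_{1,v}[d]$; that is, $s'_{2,v}$ is obtained from $s'_{1,v}$ by removing the smallest value and appending a copy of the largest value. Then $s'_v$ dominates $s'_{2,v}$, i.e. $s'_{2,v}[i]\le s'_v[i]$ for all $1\le i\le d$.
   Context: Each undirected edge $\{v,w\}$ is viewed as the two oppositely directed edges $(v,w)$ and $(w,v)$, and $e^{ -1}$ denotes the inverse of a directed edge $e$. A rotation system assigns to each vertex a cyclic ordering of the directed edges starting at it. Faces are obtained by face tracing: from a directed edge $(v,w)$ go to $(w,v)$, then to the next edge after $(w,v)$ in the cyclic order at $w$, and repeat until $(v,w)$ is reached again. A face is the resulting set of directed edges. An angle of a face is a pair of directed edges that follow each other in the facial walk. Its central vertex is the end vertex of the first edge. $A(v)$ is the set of angles with central vertex $v$; it has $\deg(v)$ elements. For an angle $\alpha$, $f(\alpha)$ is the number of directed edges of the face containing $\alpha$. A facial-like walk is a cyclic sequence $e_0,\dots,e_{k-1}$ of $k$ pairwise distinct directed edges such that, for each $0\le i<k$, the start vertex of $e_{i+1 \bmod k}$ is the end vertex of $e_i$, and $e_{i+1\bmod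 k}=e_i^{ -1}$ holds if and only if the end vertex of $e_i$ has degree $1$. For a directed edge $e$, $f_w(e)$ is the length $k$ of a shortest facial-like walk containing $e$. A sequence $s'$ is dominated by a sequence $s$ of the same length if $s'[i]\le s[i]$ for every index $i$. -}

module Defs where

open import Data.Nat using (ℕ; zero; suc; _≤_; _<_)
open import Data.Nat.Properties using (≤-decTotalOrder)
open import Data.Fin using (Fin)
open import Data.Fin.Properties using () renaming (_≟_ to _≟ᶠ_)
open import Data.List using (List; []; _∷_; _++_; length; map)
open import Data.List.Membership.Propositional using (_∈_; _∉_)
open import Data.List.Relation.Unary.Unique.Propositional using (Unique)
open import Data.List.Relation.Unary.All using (All)
open import Data.List.Relation.Binary.Pointwise using (Pointwise)
open import Data.Product using (Σ; ∃; _×_; _,_; proj₁; proj₂)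
open import Relation.Binary.PropositionalEquality using (_≡_; _≢_)
open import Relation.Binary.Construct.Closure.ReflexiveTransitive using (Star)
open import Relation.Nullary using (¬_; yes; no)
open import Function.Bundles using (_⇔_)

-- The rotation system at v is a duplicate-free list of the neighbours
-- of v, read cyclically: the directed edge (v , w) is followed in the
-- cyclic order at v by (v , next) where next is the list element after
-- w (wrapping around to the head).

record RotGraph (n : ℕ) : Set₁ where
  field
    E     : Fin n → Fin n → Set
    sym   : ∀ {u v} → E u v → E v u
    irrefl : ∀ {v} → ¬ E v v
    rot   : Fin n → List (Fin n)
    rot-unique : ∀ v → Unique (rot v)
    rot-complete : ∀ v w → (w ∈ rot v) ⇔ E v w
    connected : ∀ u w → Star E u w

Dart : ℕ → Set
Dart n = Fin n × Fin n

start end : ∀ {n} → Dart n → Fin n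
start = proj₁
end   = proj₂

inv : ∀ {n} → Dart n → Dart n
inv (v , w) = (w , v)

-- cyclic successor of w in a list (head if w is last)
-- succAux h x xs w : x is the current element, xs the rest
succAux : ∀ {n} → Fin n → Fin n → List (Fin n) → Fin n → Fin n
succAux h x [] w with x ≟ᶠ w
... | yes _ = h
... | no  _ = w
succAux h x (y ∷ xs) w with x ≟ᶠ w
... | yes _ = y
... | no  _ = succAux h y xs w

cycNext : ∀ {n} → List (Fin n) → Fin n → Fin n
cycNext [] w = w
cycNext (h ∷ t) w = succAux h h t w

module _ {n : ℕ} (G : RotGraph n) where
  open RotGraph G

  IsDart : Dart n → Set
  IsDart (v , w) = E v w

  deg : Fin n → ℕ
  deg v = length (rot v)

  -- face tracing: from (v , w) go to (w , v), then to the next edge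
  -- after (w , v) in the cyclic order at w
  faceStep : Dart n → Dart n
  faceStep (v , w) = (w , cycNext (rot w) v)

  iter : ℕ → Dart n → Dart n
  iter zero e = e
  iter (suc k) e = faceStep (iter k e)

  IsFaceSize : Dart n → ℕ → Set
  IsFaceSize e k = 1 ≤ k × iter k e ≡ e × (∀ j → 1 ≤ j → j < k → iter j e ≢ e)

  -- angles: pairs (e , faceStep e) of consecutive edges of a facial walk;
  -- central vertex = end vertex of e.
  Angle : Set
  Angle = Dart n × Dart n

  anglesAt : Fin n → List Angle
  anglesAt v = map (λ u → ((u , v) , faceStep (u , v))) (rot v)

  rotateL : List (Dart n) → List (Dart n)
  rotateL [] = []
  rotateL (x ∷ xs) = xs ++ (x ∷ [])

  zipL : List (Dart n) → List (Dart n) → List (Dart n × Dart n)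
  zipL (x ∷ xs) (y ∷ ys) = (x , y) ∷ zipL xs ys
  zipL _ _ = []

  consecutive : List (Dart n) → List (Dart n × Dart n)
  consecutive ws = zipL ws (rotateL ws)

  FLStep : Dart n × Dart n → Set
  FLStep (e , e') = start e' ≡ end e × ((e' ≡ inv e) ⇔ (deg (end e) ≡ 1))

  FacialLike : List (Dart n) → Set
  FacialLike ws = 1 ≤ length ws × Unique ws × All IsDart ws
                  × All FLStep (consecutive ws)

  IsShortestFLW : Dart n → ℕ → Set
  IsShortestFLW e k =
    (Σ (List (Dart n)) λ ws → FacialLike ws × e ∈ ws × length ws ≡ k)
    × (∀ ws → FacialLike ws → e ∈ ws → k ≤ length ws)

open import Data.List.Sort ≤-decTotalOrder using (sort)

sortℕ : List ℕ → List ℕ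
sortℕ = sort

lastOr : ℕ → List ℕ → ℕ
lastOr x [] = x
lastOr _ (y ∷ ys) = lastOr y ys

shiftSeq : List ℕ → List ℕ
shiftSeq [] = []
shiftSeq (x ∷ xs) = xs ++ (lastOr x xs ∷ [])

Dominated : List ℕ → List ℕ → Set
Dominated s' s = Pointwise _≤_ s' s

-- For a neighbour u of v write a(u) = f(u,v) for the angle at v entered by (u,v), and b(u) = f_w(v,u).
-- The facial walk through (u,v) is a facial-like walk of length a(u); it contains the dart
-- (v, u⁺) leaving v after u in the rotation, and its reversal contains (v,u).  Hence
-- b(u) ≤ a(u) and b(u⁺) ≤ a(u).  Fix a threshold t.  The first inequality gives at least as
-- many values of b as of a that are ≤ t.  If some but not all values of a are ≤ t, then
-- somewhere around v an angle with a(u) ≤ t is followed by one with a(u⁺) > t, and u⁺ gives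
-- one more value of b that is ≤ t.  For sorted sequences such counts over all t decide
-- domination, and the strict gain pays for dropping the smallest entry of the sorted b.

module Submission where

open import Defs
open import Data.Nat using (ℕ; zero; suc; _≤_; _<_; _≤?_; _⊓_; z≤n; s≤s; s≤s⁻¹; z<s; s<s)
open import Data.Nat.Properties
  using (≤-refl; ≤-reflexive; ≤-trans; <-≤-trans; <⇒≤; ≰⇒>; <⇒≱; suc-injective; m≤m+n; m≤n⇒m≤1+n;
         m⊓n≤m; m⊓n≤n; ⊓-glb; +-comm; ≤-totalOrder; ≤-decTotalOrder; module ≤-Reasoning)
open import Data.Fin using (Fin)
open import Data.Fin.Properties using (_≟_)
open import Data.List using (List; []; _∷_; _++_; _∷ʳ_; [_]; length; map; filter; zipWith; reverse; applyUpTo)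
open import Data.List.Properties
  using (length-++; length-filter; length-reverse; length-map; length-applyUpTo; filter-++; filter-all;
         filter-none; filter-accept; filter-reject; map-cong-local; map-++; map-∘; unfold-reverse)
open import Data.List.Membership.Propositional using (_∈_)
open import Data.List.Membership.Propositional.Properties using (∈-map⁺)
open import Data.List.Relation.Unary.All using (All; []; _∷_; all?)
import Data.List.Relation.Unary.All as All
open import Data.List.Relation.Unary.All.Properties using (¬All⇒Any¬; ¬Any⇒All¬)
import Data.List.Relation.Unary.All.Properties as All
open import Data.List.Relation.Unary.Any using (Any; here; there; any?)
import Data.List.Relation.Unary.Any as Any
import Data.List.Relation.Unary.Any.Properties as Any
open import Data.List.Relation.Unary.Linked using ([]; [-]; _∷_)
import Data.List.Relation.Unary.Linked as Linked
open import Data.List.Relation.Unary.Linked.Properties using (Linked⇒All)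
open import Data.List.Relation.Unary.Sorted.TotalOrder ≤-totalOrder using (Sorted)
open import Data.List.Relation.Unary.Unique.Propositional using (Unique; _∷_)
import Data.List.Relation.Unary.Unique.Propositional.Properties as Unique
open import Data.List.Relation.Binary.Pointwise using (Pointwise; []; _∷_; Pointwise-length; ++⁺)
open import Data.List.Relation.Binary.Permutation.Propositional using (_↭_; ↭-sym; prep; ↭⇒↭ₛ)
open import Data.List.Relation.Binary.Permutation.Propositional.Properties
  using (↭-length; ↭-reverse; ∷↭∷ʳ; filter-↭; ∈-resp-↭; All-resp-↭)
import Data.List.Relation.Binary.Permutation.Setoid.Properties as PermutationSetoid
open import Data.List.Sort ≤-decTotalOrder using (sort-↭; sort-↗)
open import Data.Product using (_×_; _,_; proj₁; proj₂)
open import Data.Empty using (⊥-elim)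
open import Function using (_∘_)
open import Function.Bundles using (_⇔_; mk⇔; Equivalence)
open import Relation.Nullary using (¬_; Dec; yes; no; contradiction)
open import Relation.Binary.PropositionalEquality
  using (_≡_; _≢_; refl; sym; trans; cong; cong₂; subst; subst₂; setoid)

open ≤-Reasoning

-- Counting entries up to a threshold

atMost : ℕ → List ℕ → ℕ
atMost t xs = length (filter (_≤? t) xs)

rotate : {A : Set} → List A → List A
rotate []       = []
rotate (x ∷ xs) = xs ∷ʳ x

module _ {t : ℕ} where

  atMost-accept : ∀ {x} xs → x ≤ t → atMost t (x ∷ xs) ≡ suc (atMost t xs)
  atMost-accept xs x≤t = cong length (filter-accept (_≤? t) {xs = xs} x≤t)

  atMost-reject : ∀ {x} xs → ¬ x ≤ t → atMost t (x ∷ xs) ≡ atMost t xs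
  atMost-reject xs x≰t = cong length (filter-reject (_≤? t) {xs = xs} x≰t)

  atMost-≤-length : ∀ xs → atMost t xs ≤ length xs
  atMost-≤-length = length-filter (_≤? t)

  atMost-all : ∀ {xs} → All (_≤ t) xs → atMost t xs ≡ length xs
  atMost-all all≤ = cong length (filter-all (_≤? t) all≤)

  atMost-none : ∀ {xs} → All (λ x → ¬ x ≤ t) xs → atMost t xs ≡ 0
  atMost-none none≤ = cong length (filter-none (_≤? t) none≤)

  atMost-↭ : ∀ {xs ys} → xs ↭ ys → atMost t xs ≡ atMost t ys
  atMost-↭ p = ↭-length (filter-↭ (_≤? t) p)

  atMost-rotate : ∀ xs → atMost t (rotate xs) ≡ atMost t xs
  atMost-rotate []       = refl
  atMost-rotate (x ∷ xs) = sym (atMost-↭ (∷↭∷ʳ x xs))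

  atMost-cons : ∀ x xs → atMost t xs ≤ atMost t (x ∷ xs)
  atMost-cons x xs with x ≤? t
  ... | yes x≤t = subst (atMost t xs ≤_) (sym (atMost-accept xs x≤t)) (m≤n⇒m≤1+n ≤-refl)
  ... | no  x≰t = subst (atMost t xs ≤_) (sym (atMost-reject xs x≰t)) ≤-refl

  atMost-antitone : ∀ {xs ys} → Pointwise _≤_ xs ys → atMost t ys ≤ atMost t xs
  atMost-antitone [] = z≤n
  atMost-antitone {x ∷ xs} {y ∷ ys} (x≤y ∷ xs≤ys) with y ≤? t
  ... | yes y≤t = subst₂ _≤_ (sym (atMost-accept ys y≤t)) (sym (atMost-accept xs (≤-trans x≤y y≤t)))
                    (s≤s (atMost-antitone xs≤ys))
  ... | no  y≰t = subst (_≤ atMost t (x ∷ xs)) (sym (atMost-reject ys y≰t))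
                    (≤-trans (atMost-antitone xs≤ys) (atMost-cons x xs))

  atMost-++ : ∀ xs ys → atMost t xs ≤ atMost t (xs ++ ys)
  atMost-++ xs ys = subst (atMost t xs ≤_)
    (sym (trans (cong length (filter-++ (_≤? t) xs ys)) (length-++ (filter (_≤? t) xs))))
    (m≤m+n _ _)

  atMost-shiftSeq : ∀ xs → atMost t xs ≤ suc (atMost t (shiftSeq xs))
  atMost-shiftSeq []       = z≤n
  atMost-shiftSeq (x ∷ xs) with x ≤? t
  ... | yes x≤t = subst (_≤ suc (atMost t (shiftSeq (x ∷ xs)))) (sym (atMost-accept xs x≤t)) (s≤s (atMost-++ xs _))
  ... | no  x≰t = subst (_≤ suc (atMost t (shiftSeq (x ∷ xs)))) (sym (atMost-reject xs x≰t)) (m≤n⇒m≤1+n (atMost-++ xs _))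

  zipWith-⊓-≤ʳ : ∀ x ys z → Pointwise _≤_ (zipWith _⊓_ (x ∷ ys) (ys ∷ʳ z)) (ys ∷ʳ z)
  zipWith-⊓-≤ʳ x []       z = m⊓n≤n x z ∷ []
  zipWith-⊓-≤ʳ x (y ∷ ys) z = m⊓n≤n x y ∷ zipWith-⊓-≤ʳ y ys z

  -- The left list is ys ∷ʳ z, the right one pairs each of its entries with the minimum of it and
  -- its predecessor; an adjacent pair u ≤ t < w is counted on the right but not on the left.
  atMost-zipWith-⊓-startBelow : ∀ {x} ys {z} → x ≤ t → Any (t <_) (ys ∷ʳ z) →
    atMost t (ys ∷ʳ z) < atMost t (zipWith _⊓_ (x ∷ ys) (ys ∷ʳ z))
  atMost-zipWith-⊓-startBelow {x} [] {z} x≤t (here t<z) =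
    subst₂ _<_ (sym (atMost-reject [] (<⇒≱ t<z))) (sym (atMost-accept [] (≤-trans (m⊓n≤m x z) x≤t))) z<s
  atMost-zipWith-⊓-startBelow {x} (y ∷ ys) {z} x≤t ascent with y ≤? t
  ... | yes y≤t = subst₂ _<_ (sym (atMost-accept _ y≤t)) (sym (atMost-accept _ (≤-trans (m⊓n≤n x y) y≤t)))
        (s<s (atMost-zipWith-⊓-startBelow ys y≤t (later ascent)))
    where
    later : Any (t <_) (y ∷ ys ∷ʳ z) → Any (t <_) (ys ∷ʳ z)
    later (here t<y) = ⊥-elim (<⇒≱ t<y y≤t)
    later (there p)  = p
  ... | no  y≰t = subst₂ _<_ (sym (atMost-reject _ y≰t)) (sym (atMost-accept _ (≤-trans (m⊓n≤m x y) x≤t)))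
        (s≤s (atMost-antitone (zipWith-⊓-≤ʳ y ys z)))

  atMost-zipWith-⊓-endAbove : ∀ {x} ys {z} → Any (_≤ t) (x ∷ ys) → t < z →
    atMost t (ys ∷ʳ z) < atMost t (zipWith _⊓_ (x ∷ ys) (ys ∷ʳ z))
  atMost-zipWith-⊓-endAbove ys (here x≤t) t<z = atMost-zipWith-⊓-startBelow ys x≤t (Any.++⁺ʳ ys (here t<z))
  atMost-zipWith-⊓-endAbove {x} (y ∷ ys) {z} (there below) t<z with y ≤? t
  ... | yes y≤t = subst₂ _<_ (sym (atMost-accept (ys ∷ʳ z) y≤t))
        (sym (atMost-accept (zipWith _⊓_ (y ∷ ys) (ys ∷ʳ z)) (≤-trans (m⊓n≤n x y) y≤t)))
        (s<s (atMost-zipWith-⊓-endAbove ys below t<z))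
  ... | no  y≰t = subst (_< atMost t (zipWith _⊓_ (x ∷ y ∷ ys) (y ∷ ys ∷ʳ z))) (sym (atMost-reject (ys ∷ʳ z) y≰t))
        (<-≤-trans (atMost-zipWith-⊓-endAbove ys below t<z) (atMost-cons (x ⊓ y) _))

  atMost-zipWith-⊓-rotate : ∀ xs → Any (_≤ t) xs → Any (t <_) xs →
    atMost t xs < atMost t (zipWith _⊓_ xs (rotate xs))
  atMost-zipWith-⊓-rotate (x ∷ xs) below above =
    subst (_< atMost t (zipWith _⊓_ (x ∷ xs) (xs ∷ʳ x))) (atMost-rotate (x ∷ xs)) (crossing (x ≤? t) above)
    where
    crossing : Dec (x ≤ t) → Any (t <_) (x ∷ xs) →
      atMost t (xs ∷ʳ x) < atMost t (zipWith _⊓_ (x ∷ xs) (xs ∷ʳ x))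
    crossing (yes x≤t) (here t<x)     = ⊥-elim (<⇒≱ t<x x≤t)
    crossing (yes x≤t) (there above′) = atMost-zipWith-⊓-startBelow xs x≤t (Any.++⁺ˡ above′)
    crossing (no  x≰t) _              = atMost-zipWith-⊓-endAbove xs below (≰⇒> x≰t)

sorted-atMost-below-head : ∀ {t x xs} → Sorted (x ∷ xs) → t < x → atMost t (x ∷ xs) ≡ 0
sorted-atMost-below-head sorted t<x =
  atMost-none (All.map (λ x≤y → <⇒≱ (<-≤-trans t<x x≤y)) (Linked⇒All ≤-trans ≤-refl sorted))

sorted-dominated : ∀ {xs ys} → Sorted xs → Sorted ys → length xs ≡ length ys →
  (∀ t → atMost t ys ≤ atMost t xs) → Pointwise _≤_ xs ys
sorted-dominated {[]}     {[]}     _  _  _    _      = []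
sorted-dominated {x ∷ xs} {y ∷ ys} sx sy same counts = x≤y ∷ sorted-dominated (Linked.tail sx) (Linked.tail sy)
  (suc-injective same) tail-counts
  where
  x≤y : x ≤ y
  x≤y with x ≤? y
  ... | yes x≤y = x≤y
  ... | no  x≰y = ⊥-elim (<⇒≱ z<s (subst₂ _≤_ (atMost-accept {y} ys ≤-refl) (sorted-atMost-below-head sx (≰⇒> x≰y))
                                                 (counts y)))
  tail-counts : ∀ t → atMost t ys ≤ atMost t xs
  tail-counts t with y ≤? t
  ... | yes y≤t = s≤s⁻¹ (subst₂ _≤_ (atMost-accept ys y≤t) (atMost-accept xs (≤-trans x≤y y≤t)) (counts t))
  ... | no  y≰t = subst (_≤ atMost t xs)
                    (sym (trans (sym (atMost-reject ys y≰t)) (sorted-atMost-below-head sy (≰⇒> y≰t)))) z≤n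

sorted-∷ʳ-lastOr : ∀ {x xs} → Sorted (x ∷ xs) → Sorted (x ∷ xs ∷ʳ lastOr x xs)
sorted-∷ʳ-lastOr {xs = []}    [-]            = ≤-refl ∷ [-]
sorted-∷ʳ-lastOr {xs = _ ∷ _} (x≤y ∷ sorted) = x≤y ∷ sorted-∷ʳ-lastOr sorted

shiftSeq-sorted : ∀ {xs} → Sorted xs → Sorted (shiftSeq xs)
shiftSeq-sorted {[]}    _      = []
shiftSeq-sorted {_ ∷ _} sorted = Linked.tail (sorted-∷ʳ-lastOr sorted)

length-shiftSeq : ∀ xs → length (shiftSeq xs) ≡ length xs
length-shiftSeq []       = refl
length-shiftSeq (x ∷ xs) = trans (length-++ xs) (+-comm (length xs) 1)

All-lastOr : ∀ {P : ℕ → Set} {x xs} → All P (x ∷ xs) → P (lastOr x xs)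
All-lastOr (px ∷ [])       = px
All-lastOr (_ ∷ py ∷ pys)  = All-lastOr (py ∷ pys)

All-shiftSeq : ∀ {P : ℕ → Set} {xs} → All P xs → All P (shiftSeq xs)
All-shiftSeq []                 = []
All-shiftSeq all@(_ ∷ pxs)      = All.++⁺ pxs (All-lastOr all ∷ [])

rotate⁺ : ∀ {A B : Set} {R : A → B → Set} {xs ys} → Pointwise R xs ys → Pointwise R (rotate xs) (rotate ys)
rotate⁺ []         = []
rotate⁺ (r ∷ rs)   = ++⁺ rs (r ∷ [])

All⇒Pointwise-map : ∀ {A : Set} {f g : A → ℕ} {xs} → All (λ x → f x ≤ g x) xs → Pointwise _≤_ (map f xs) (map g xs)
All⇒Pointwise-map []         = []
All⇒Pointwise-map (p ∷ ps)   = p ∷ All⇒Pointwise-map ps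

Pointwise-⊓ : ∀ {xs ys zs} → Pointwise _≤_ xs ys → Pointwise _≤_ xs zs → Pointwise _≤_ xs (zipWith _⊓_ ys zs)
Pointwise-⊓ []         []         = []
Pointwise-⊓ (p ∷ ps)   (q ∷ qs)   = ⊓-glb p q ∷ Pointwise-⊓ ps qs

All-≤-antitone : ∀ {t xs ys} → Pointwise _≤_ xs ys → All (_≤ t) ys → All (_≤ t) xs
All-≤-antitone []           []           = []
All-≤-antitone (x≤y ∷ rest) (y≤t ∷ ys≤t) = ≤-trans x≤y y≤t ∷ All-≤-antitone rest ys≤t

shiftSeq-sort-dominated : ∀ {as bs} → Pointwise _≤_ bs as → Pointwise _≤_ (rotate bs) as →
  Dominated (shiftSeq (sortℕ bs)) (sortℕ as)
shiftSeq-sort-dominated {as} {bs} bs≤as rotated≤as =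
  sorted-dominated (shiftSeq-sorted (sort-↗ bs)) (sort-↗ as) same-length
    (λ t → subst (_≤ atMost t X′) (sym (atMost-↭ (sort-↭ as))) (bound t))
  where
  X′ = shiftSeq (sortℕ bs)
  length-X′ : length X′ ≡ length as
  length-X′ = trans (length-shiftSeq (sortℕ bs)) (trans (↭-length (sort-↭ bs)) (Pointwise-length bs≤as))
  same-length : length X′ ≡ length (sortℕ as)
  same-length = trans length-X′ (sym (↭-length (sort-↭ as)))
  bound : ∀ t → atMost t as ≤ atMost t X′
  bound t with all? (_≤? t) as
  ... | yes all≤ = ≤-trans (atMost-≤-length as) (≤-reflexive (sym (trans (atMost-all X′≤t) length-X′)))
    where
    X′≤t : All (_≤ t) X′
    X′≤t = All-shiftSeq (All-resp-↭ (↭-sym (sort-↭ bs)) (All-≤-antitone bs≤as all≤))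
  ... | no ¬all≤ with any? (_≤? t) as
  ...   | no ¬some≤ = subst (_≤ atMost t X′) (sym (atMost-none (¬Any⇒All¬ as ¬some≤))) z≤n
  ...   | yes some≤ = s≤s⁻¹ (begin-strict
    atMost t as                                  <⟨ atMost-zipWith-⊓-rotate as some≤ some> ⟩
    atMost t (zipWith _⊓_ as (rotate as))        ≤⟨ atMost-antitone (Pointwise-⊓ rotated≤as (rotate⁺ bs≤as)) ⟩
    atMost t (rotate bs)                         ≡⟨ atMost-rotate bs ⟩
    atMost t bs                                  ≡⟨ atMost-↭ (↭-sym (sort-↭ bs)) ⟩
    atMost t (sortℕ bs)                          ≤⟨ atMost-shiftSeq (sortℕ bs) ⟩
    suc (atMost t X′)                            ∎)
    where
    some> : Any (t <_) as
    some> = Any.map ≰⇒> (¬All⇒Any¬ (_≤? t) as ¬all≤)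

-- The cyclic successor in a rotation

Unique-resp-↭ : ∀ {A : Set} {xs ys : List A} → xs ↭ ys → Unique xs → Unique ys
Unique-resp-↭ {A} xs↭ys = PermutationSetoid.Unique-resp-↭ (setoid A) (↭⇒↭ₛ xs↭ys)

Unique-map-injective : ∀ {A B : Set} {f : A → B} {xs x y} → Unique (map f xs) → x ∈ xs → y ∈ xs → f x ≡ f y → x ≡ y
Unique-map-injective         (_ ∷ _)       (here refl) (here refl) _  = refl
Unique-map-injective {f = f} (fx∉ ∷ _)     (here refl) (there y∈) eq = contradiction eq (All.lookup fx∉ (∈-map⁺ f y∈))
Unique-map-injective {f = f} (fy∉ ∷ _)     (there x∈) (here refl) eq = contradiction (sym eq) (All.lookup fy∉ (∈-map⁺ f x∈))
Unique-map-injective         (_ ∷ unique)  (there x∈) (there y∈) eq = Unique-map-injective unique x∈ y∈ eq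

rotate-map : ∀ {A B : Set} (f : A → B) xs → rotate (map f xs) ≡ map f (rotate xs)
rotate-map f []       = refl
rotate-map f (x ∷ xs) = sym (map-++ f xs [ x ])

module _ {n : ℕ} where

  succAux-last : ∀ (h x : Fin n) → succAux h x [] x ≡ h
  succAux-last h x with x ≟ x
  ... | yes _   = refl
  ... | no  x≢x = contradiction refl x≢x

  succAux-here : ∀ (h x y : Fin n) ys → succAux h x (y ∷ ys) x ≡ y
  succAux-here h x y ys with x ≟ x
  ... | yes _   = refl
  ... | no  x≢x = contradiction refl x≢x

  succAux-skip : ∀ {h x y : Fin n} {ys w} → x ≢ w → succAux h x (y ∷ ys) w ≡ succAux h y ys w
  succAux-skip {x = x} {w = w} x≢w with x ≟ w
  ... | yes x≡w = contradiction x≡w x≢w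
  ... | no  _   = refl

  map-succAux : ∀ (h x : Fin n) xs → Unique (x ∷ xs) → map (succAux h x xs) (x ∷ xs) ≡ xs ∷ʳ h
  map-succAux h x []       _              = cong [_] (succAux-last h x)
  map-succAux h x (y ∷ ys) (x∉ ∷ unique) = cong₂ _∷_ (succAux-here h x y ys)
    (trans (map-cong-local (All.map succAux-skip x∉)) (map-succAux h y ys unique))

  succAux-fixed : ∀ (h x : Fin n) xs {w} → Unique (x ∷ xs) → w ∈ x ∷ xs → succAux h x xs w ≡ w → h ≡ w
  succAux-fixed h x []       _               (here refl) fixed = trans (sym (succAux-last h x)) fixed
  succAux-fixed h x (y ∷ ys) {w} (x∉ ∷ unique) w∈ fixed with x ≟ w | w∈
  ... | yes refl | _          = contradiction (sym fixed) (All.lookup x∉ (here refl))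
  ... | no  x≢w  | here x≡w   = contradiction (sym x≡w) x≢w
  ... | no  x≢w  | there w∈′  = succAux-fixed h y ys unique w∈′ fixed

  map-cycNext : ∀ {L : List (Fin n)} → Unique L → map (cycNext L) L ≡ rotate L
  map-cycNext {[]}    _      = refl
  map-cycNext {h ∷ t} unique = map-succAux h h t unique

  cycNext-∈ : ∀ {L : List (Fin n)} {w} → Unique L → w ∈ L → cycNext L w ∈ L
  cycNext-∈ {h ∷ t} {w} unique w∈ =
    ∈-resp-↭ (↭-sym (∷↭∷ʳ h t)) (subst (cycNext (h ∷ t) w ∈_) (map-cycNext unique) (∈-map⁺ (cycNext (h ∷ t)) w∈))

  cycNext-injective : ∀ {L : List (Fin n)} {w w′} → Unique L → w ∈ L → w′ ∈ L → cycNext L w ≡ cycNext L w′ → w ≡ w′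
  cycNext-injective {h ∷ t} unique = Unique-map-injective
    (subst Unique (sym (map-cycNext unique)) (Unique-resp-↭ (∷↭∷ʳ h t) unique))

  cycNext-fixed : ∀ {L : List (Fin n)} {w} → Unique L → w ∈ L → cycNext L w ≡ w ⇔ length L ≡ 1
  cycNext-fixed {h ∷ []}    _ (here refl) = mk⇔ (λ _ → refl) (λ _ → succAux-last h h)
  cycNext-fixed {h ∷ y ∷ ys} unique@(h∉ ∷ _) w∈ = mk⇔ absurd (λ ())
    where
    absurd : cycNext (h ∷ y ∷ ys) _ ≡ _ → suc (suc (length ys)) ≡ 1
    absurd fixed with refl ← succAux-fixed h h (y ∷ ys) unique w∈ fixed =
      contradiction (sym (trans (sym (succAux-here h h y ys)) fixed)) (All.lookup h∉ (here refl))

-- Facial walks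

pathPairs : ∀ {A : Set} → A → List A → A → List (A × A)
pathPairs x []       y = (x , y) ∷ []
pathPairs x (z ∷ zs) y = (x , z) ∷ pathPairs z zs y

pathPairs-∷ʳ : ∀ {A : Set} (x : A) ws z y → pathPairs x (ws ∷ʳ z) y ≡ pathPairs x ws z ∷ʳ (z , y)
pathPairs-∷ʳ x []       z y = refl
pathPairs-∷ʳ x (w ∷ ws) z y = cong ((x , w) ∷_) (pathPairs-∷ʳ w ws z y)

pathPairs-applyUpTo : ∀ {A : Set} {P : A × A → Set} (f : ℕ → A) → (∀ i → P (f i , f (suc i))) →
  ∀ m → All P (pathPairs (f 0) (applyUpTo (f ∘ suc) m) (f (suc m)))
pathPairs-applyUpTo f step zero    = step 0 ∷ []
pathPairs-applyUpTo f step (suc m) = step 0 ∷ pathPairs-applyUpTo (f ∘ suc) (step ∘ suc) m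

pathPairs-reverse : ∀ {A B : Set} {P : A × A → Set} {Q : B × B → Set} (g : A → B) →
  (∀ {p q} → P (p , q) → Q (g q , g p)) →
  ∀ x zs y → All P (pathPairs x zs y) → All Q (pathPairs (g y) (reverse (map g zs)) (g x))
pathPairs-reverse g flip x []       y (pxy ∷ []) = flip pxy ∷ []
pathPairs-reverse g flip x (z ∷ zs) y (pxz ∷ ps) =
  subst (All _) (sym (trans (cong (λ ws → pathPairs (g y) ws (g x)) (unfold-reverse (g z) (map g zs)))
                            (pathPairs-∷ʳ (g y) (reverse (map g zs)) (g z) (g x))))
    (All.++⁺ (pathPairs-reverse g flip z zs y ps) (flip pxz ∷ []))

↭-∷-reverse : ∀ {A : Set} (x : A) xs → x ∷ xs ↭ x ∷ reverse xs
↭-∷-reverse x xs = prep x (↭-sym (↭-reverse xs))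

inv-injective : ∀ {n} {d d′ : Dart n} → inv d ≡ inv d′ → d ≡ d′
inv-injective {d = _ , _} {d′ = _ , _} eq = cong inv eq

module _ {n : ℕ} (G : RotGraph n) where
  open RotGraph G renaming (sym to E-sym)

  neighbour-∈ : ∀ {v w} → E v w → w ∈ rot v
  neighbour-∈ {v} {w} = Equivalence.from (rot-complete v w)

  inv-dart : ∀ {d} → IsDart G d → IsDart G (inv d)
  inv-dart = E-sym

  faceStep-dart : ∀ {d} → IsDart G d → IsDart G (faceStep G d)
  faceStep-dart {a , b} e = Equivalence.to (rot-complete b _) (cycNext-∈ (rot-unique b) (neighbour-∈ (E-sym e)))

  faceStep-injective : ∀ {d d′} → IsDart G d → IsDart G d′ → faceStep G d ≡ faceStep G d′ → d ≡ d′
  faceStep-injective {a , b} {a′ , b′} e e′ eq with cong proj₁ eq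
  ... | refl = cong (_, b)
    (cycNext-injective (rot-unique b) (neighbour-∈ (E-sym e)) (neighbour-∈ (E-sym e′)) (cong proj₂ eq))

  faceStep-FLStep : ∀ {d} → IsDart G d → FLStep G (d , faceStep G d)
  faceStep-FLStep {a , b} e = refl , mk⇔ (Equivalence.to fixed ∘ cong proj₂) (cong (b ,_) ∘ Equivalence.from fixed)
    where
    fixed = cycNext-fixed (rot-unique b) (neighbour-∈ (E-sym e))

  FLStep-reverse : ∀ {d d′} → FLStep G (d , d′) → FLStep G (inv d′ , inv d)
  FLStep-reverse {_ , _} {_ , _} (refl , turn) = refl , mk⇔ (Equivalence.to turn ∘ sym) (sym ∘ Equivalence.from turn)

  consecutive-pathPairs : ∀ x xs → consecutive G (x ∷ xs) ≡ pathPairs x xs x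
  consecutive-pathPairs x xs = zipL-pathPairs x xs x
    where
    zipL-pathPairs : ∀ x xs y → zipL G (x ∷ xs) (xs ∷ʳ y) ≡ pathPairs x xs y
    zipL-pathPairs x []       y = refl
    zipL-pathPairs x (z ∷ zs) y = cong ((x , z) ∷_) (zipL-pathPairs z zs y)

  FacialLike-reverse : ∀ {x xs} → FacialLike G (x ∷ xs) → FacialLike G (inv x ∷ reverse (map inv xs))
  FacialLike-reverse {x} {xs} (_ , unique , darts , steps) =
    s≤s z≤n ,
    Unique-resp-↭ (↭-∷-reverse (inv x) (map inv xs)) (Unique.map⁺ inv-injective unique) ,
    All-resp-↭ (↭-∷-reverse (inv x) (map inv xs)) (All.map⁺ (All.map inv-dart darts)) ,
    subst (All (FLStep G)) (sym (consecutive-pathPairs (inv x) _))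
      (pathPairs-reverse inv FLStep-reverse x xs x (subst (All (FLStep G)) (consecutive-pathPairs x xs) steps))

  orbit : Dart n → ℕ → List (Dart n)
  orbit e k = applyUpTo (λ i → iter G i e) k

  iter-dart : ∀ {e} → IsDart G e → ∀ i → IsDart G (iter G i e)
  iter-dart de zero    = de
  iter-dart de (suc i) = faceStep-dart (iter-dart de i)

  iter-distinct : ∀ {e k} → IsDart G e → IsFaceSize G e k → ∀ {i j} → i < j → j < k → iter G i e ≢ iter G j e
  iter-distinct de (_ , _ , minimal) {zero}  {suc j} _       j<k eq = minimal (suc j) (s≤s z≤n) j<k (sym eq)
  iter-distinct de size              {suc i} {suc j} (s<s i<j) j<k eq =
    iter-distinct de size i<j (<⇒≤ j<k) (faceStep-injective (iter-dart de i) (iter-dart de j) eq)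

  orbit-facialLike : ∀ {e k} → IsDart G e → IsFaceSize G e k → FacialLike G (orbit e k)
  orbit-facialLike {e} {suc m} de size@(_ , closed , _) =
    s≤s z≤n ,
    Unique.applyUpTo⁺₁ _ (suc m) (iter-distinct de size) ,
    All.applyUpTo⁺₂ _ (suc m) (iter-dart de) ,
    subst (All (FLStep G)) (sym (consecutive-pathPairs e _))
      (subst (λ e′ → All (FLStep G) (pathPairs e (applyUpTo (λ i → iter G (suc i) e) m) e′)) closed
        (pathPairs-applyUpTo (λ i → iter G i e) (λ i → faceStep-FLStep (iter-dart de i)) m))

  faceStep-∈-orbit : ∀ {e k} → IsFaceSize G e k → faceStep G e ∈ orbit e k
  faceStep-∈-orbit {k = suc zero}    (_ , closed , _) = here closed
  faceStep-∈-orbit {k = suc (suc m)} _                = there (here refl)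

  faceStep-shortest≤faceSize : ∀ {d k l} → IsDart G d → IsFaceSize G d k → IsShortestFLW G (faceStep G d) l → l ≤ k
  faceStep-shortest≤faceSize {d} {k} {l} dd size (_ , shortest) =
    subst (l ≤_) (length-applyUpTo _ k) (shortest _ (orbit-facialLike dd size) (faceStep-∈-orbit size))

  inv-shortest≤faceSize : ∀ {d k l} → IsDart G d → IsFaceSize G d k → IsShortestFLW G (inv d) l → l ≤ k
  inv-shortest≤faceSize {d} {suc m} {l} dd size (_ , shortest) =
    subst (l ≤_) (cong suc (trans (length-reverse (map inv R)) (trans (length-map inv R) (length-applyUpTo _ m))))
      (shortest _ (FacialLike-reverse (orbit-facialLike dd size)) (here refl))
    where
    R = applyUpTo (λ i → iter G (suc i) d) m

mainTheorem1 : ∀ {n} (G : RotGraph n)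
    (f : Dart n → ℕ) (f-spec : ∀ e → IsDart G e → IsFaceSize G e (f e))
    (fw : Dart n → ℕ) (fw-spec : ∀ e → IsDart G e → IsShortestFLW G e (fw e))
    (v : Fin n) →
    Dominated
      (shiftSeq (sortℕ (map (λ w → fw (v , w)) (RotGraph.rot G v))))
      (sortℕ (map (λ α → f (proj₁ α)) (anglesAt G v)))
mainTheorem1 {n} G f f-spec fw fw-spec v =
  subst (Dominated (shiftSeq (sortℕ (map b L))) ∘ sortℕ) (map-∘ L) (shiftSeq-sort-dominated b≤a next-b≤a)
  where
  open RotGraph G renaming (sym to E-sym)
  L = rot v
  a b : Fin n → ℕ
  a u = f (u , v)
  b u = fw (v , u)
  into-v : ∀ {u} → u ∈ L → IsDart G (u , v)
  into-v {u} u∈ = E-sym (Equivalence.to (rot-complete v u) u∈)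
  b≤a : Pointwise _≤_ (map b L) (map a L)
  b≤a = All⇒Pointwise-map (All.tabulate λ u∈ →
    inv-shortest≤faceSize G (into-v u∈) (f-spec _ (into-v u∈)) (fw-spec _ (inv-dart G (into-v u∈))))
  next-b≤a : Pointwise _≤_ (rotate (map b L)) (map a L)
  next-b≤a = subst (λ bs → Pointwise _≤_ bs (map a L))
    (trans (map-∘ L) (trans (cong (map b) (map-cycNext (rot-unique v))) (sym (rotate-map b L))))
    (All⇒Pointwise-map (All.tabulate λ u∈ →
      faceStep-shortest≤faceSize G (into-v u∈) (f-spec _ (into-v u∈)) (fw-spec _ (faceStep-dart G (into-v u∈)))))
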